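{- Let $(\mathcal{B},\nu)$ be an effective topology with a recursively enumerable subset relation, and let $\phi$ be an oracle for a point $x$ in $(\mathcal{B},\nu)$. Then there exists a complete oracle $\psi$ for $x$ in $(\mathcal{B},\nu)$ that is recursive relative to $\phi$ uniformly.
   Context: Let $X$ be a set with a topology having a countable basis $\mathcal{B}$. A coding of $\mathcal{B}$ is a (not necessarily injective) assignment $n\mapsto\nu(n)$ of basis elements to non-negative integers, every basis element being coded by at least one integer; $\mathrm{dom}_{\mathcal{B}}\nu$ denotes the set of non-negative integers $n$ with $\nu(n)\in\mathcal{B}$. $(\mathcal{B},\nu)$ is an effective topology iff $\mathcal{B}$ is a countable basis for a $T_0$ topology and $\nu$ is a coding of $\mathcal{B}$. A set $\mathcal{L}_x\subseteq\mathcal{B}$ is a local basis for $x\in X$ iff every $L\in\mathcal{L}_x$ contains $x$ and for every $B\in\mathcal{B}$ with $x\in B$ there exists $L\in\mathcal{L}_x$ with $L\subseteq B$. Writing $\mathbb{N}$ for the non-negative integers and $\nu(C)=\{\nu(c):c\in C\}$, a function $\phi:\mathbb{N}\to\mathrm{dom}_{\mathcal{B}}\nu$ is an oracle for $x$ iff $\nu(\phi(\mathbb{N}))$ is a local basis for $x$; it is complete iff every $n\in\mathrm{dom}_{\mathcal{B}}\nu$ with $x\in\nu(n)$ lies in $\phi(\mathbb{N})$. The effective topology has a recursively enumerable subset relation iff $\{\langle b_1,b_2\rangle: b_1,b_2\in\mathrm{dom}_{\mathcal{B}}\nu,\ \nu(b_1)\subseteq\nu(b_2)\}$ is recursively enumerable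 (with $\langle\cdot,\cdot\rangle$ Cantor's pairing function). "Recursive relative to $\phi$ uniformly" means computed from $\phi$ by an oracle Turing machine that does not depend on $\phi$ (or $x$). -}

module Defs where

open import Data.Nat using (ℕ; zero; suc; _+_; _<_)
open import Data.Fin using (Fin)
open import Data.Vec using (Vec; []; _∷_; lookup)
open import Data.Product using (Σ; _×_; ∃)
open import Data.Sum using (_⊎_)
open import Data.Empty using (⊥)
open import Relation.Binary.PropositionalEquality using (_≡_)
open import Function.Bundles using (_⇔_)

-- Cantor's pairing function  ⟨a,b⟩ = (a+b)(a+b+1)/2 + b

triangle : ℕ → ℕ
triangle zero    = 0
triangle (suc n) = suc n + triangle n

⟨_,_⟩ : ℕ → ℕ → ℕ
⟨ a , b ⟩ = triangle (a + b) + b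

-- Oracle (partial) recursive functions: Kleene's mu-recursive functions
-- with one extra basic function `orac`, the oracle φ : ℕ → ℕ.
-- Code n = programs of arity n.

data Code : ℕ → Set where
  zer  : ∀ {n} → Code n
  succ : Code 1
  proj : ∀ {n} → Fin n → Code n
  orac : Code 1
  comp : ∀ {n m} → Code m → Vec (Code n) m → Code n
  prec : ∀ {n} → Code n → Code (suc (suc n)) → Code (suc n)
  mu   : ∀ {n} → Code (suc n) → Code n

-- Big-step semantics relative to an oracle φ:
-- Eval φ c xs y  means  the program c on input xs halts with output y.
mutual
  data Eval (φ : ℕ → ℕ) : ∀ {n} → Code n → Vec ℕ n → ℕ → Set where
    ev-zer  : ∀ {n} {xs : Vec ℕ n} → Eval φ zer xs 0
    ev-succ : ∀ {x} → Eval φ succ (x ∷ []) (suc x)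
    ev-proj : ∀ {n} {i : Fin n} {xs} → Eval φ (proj i) xs (lookup xs i)
    ev-orac : ∀ {x} → Eval φ orac (x ∷ []) (φ x)
    ev-comp : ∀ {n m} {f : Code m} {gs : Vec (Code n) m} {xs ys y} →
              EvalAll φ gs xs ys → Eval φ f ys y → Eval φ (comp f gs) xs y
    ev-prec-zero : ∀ {n} {g : Code n} {h} {xs y} →
              Eval φ g xs y → Eval φ (prec g h) (0 ∷ xs) y
    ev-prec-suc  : ∀ {n} {g : Code n} {h} {k xs y z} →
              Eval φ (prec g h) (k ∷ xs) y → Eval φ h (k ∷ y ∷ xs) z →
              Eval φ (prec g h) (suc k ∷ xs) z
    ev-mu   : ∀ {n} {f : Code (suc n)} {xs y} →
              Eval φ f (y ∷ xs) 0 →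
              (∀ i → i < y → Σ ℕ (λ z → Eval φ f (i ∷ xs) (suc z))) →
              Eval φ (mu f) xs y

  data EvalAll (φ : ℕ → ℕ) {n} : ∀ {m} → Vec (Code n) m → Vec ℕ n → Vec ℕ m → Set where
    []  : ∀ {xs} → EvalAll φ [] xs []
    _∷_ : ∀ {m} {g} {gs : Vec (Code n) m} {xs y ys} →
          Eval φ g xs y → EvalAll φ gs xs ys → EvalAll φ (g ∷ gs) xs (y ∷ ys)

ComputedBy : (φ : ℕ → ℕ) → Code 1 → (ℕ → ℕ) → Set
ComputedBy φ c ψ = ∀ n → Eval φ c (n ∷ []) (ψ n)

-- Plain (oracle-free) recursiveness: computation relative to the
-- constant-zero oracle (which is itself recursive).
noOracle : ℕ → ℕ
noOracle _ = 0

RecEnum : (ℕ → Set) → Set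
RecEnum S = (∀ n → S n → ⊥)
          ⊎ Σ (Code 1) (λ c → Σ (ℕ → ℕ) (λ e →
               ComputedBy noOracle c e × (∀ n → S n ⇔ ∃ (λ k → e k ≡ n))))

-- A coding ν assigns to each n a subset ν n of X; dom n expresses
-- n ∈ dom_B ν (ν n is a basis element).  The basis B is the set
-- { ν n | dom n }, so every basis element is coded by some integer.

module _ {X : Set} (dom : ℕ → Set) (ν : ℕ → X → Set) where

  _⊆ν_ : ℕ → ℕ → Set
  a ⊆ν b = ∀ y → ν a y → ν b y

  IsBasis : Set
  IsBasis = (∀ x → Σ ℕ (λ n → dom n × ν n x))
          × (∀ a b x → dom a → dom b → ν a x → ν b x →
               Σ ℕ (λ c → dom c × ν c x × (c ⊆ν a) × (c ⊆ν b)))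

  IsT0 : Set
  IsT0 = ∀ x y → (∀ n → dom n → (ν n x ⇔ ν n y)) → x ≡ y

  IsEffectiveTopology : Set
  IsEffectiveTopology = IsBasis × IsT0

  REsubset : Set
  REsubset = RecEnum (λ m → Σ ℕ (λ b₁ → Σ ℕ (λ b₂ →
               (m ≡ ⟨ b₁ , b₂ ⟩) × dom b₁ × dom b₂ × (b₁ ⊆ν b₂))))

  IsOracle : X → (ℕ → ℕ) → Set
  IsOracle x φ = (∀ k → dom (φ k))
               × (∀ k → ν (φ k) x)
               × (∀ n → dom n → ν n x → Σ ℕ (λ k → φ k ⊆ν n))

  IsCompleteOracle : X → (ℕ → ℕ) → Set
  IsCompleteOracle x φ = IsOracle x φ
               × (∀ n → dom n → ν n x → Σ ℕ (λ k → φ k ≡ n))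

-- Let e be a total recursive enumeration of the codes ⟨b₁,b₂⟩ of all pairs of
-- basis codes with ν b₁ ⊆ ν b₂, and let φ be an oracle for x.  Define
--
--     ψ ⟨j,k⟩ = b₂   if e j = ⟨b₁,b₂⟩ and b₁ = φ k,     ψ ⟨j,k⟩ = φ 0 otherwise.
--
-- Every value of ψ is a basic neighbourhood of x (it contains some φ k ∋ x),
-- and every basic neighbourhood n of x contains some φ k, so ⟨φ k,n⟩ = e j
-- for some j and ψ ⟨j,k⟩ = n: ψ is a complete oracle.  If the subset
-- relation is the empty r.e. set, no oracle can exist (⟨φ 0,φ 0⟩ would be in it).
module Submission where

open import Defs
open import Data.Nat using (ℕ; zero; suc; _+_; _∸_; _≤_; _<_; z≤n; s≤s; pred; _≤?_)
open import Data.Nat.Properties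
open import Data.Fin using (Fin) renaming (zero to #0; suc to #suc)
open import Data.Vec using (Vec; []; _∷_; lookup; head)
open import Data.Product using (Σ; _×_; _,_; proj₁; proj₂; ∃)
open import Data.Sum using (inj₁; inj₂)
open import Data.Empty using (⊥-elim)
open import Relation.Nullary using (yes; no)
open import Relation.Binary.PropositionalEquality
open import Function.Bundles using (_⇔_; Equivalence)
open import Relation.Binary.Definitions using (tri<; tri≈; tri>)

-- Oracle-free programs are oracle-independent: replacing every oracle call by
-- the constant 0 yields a program that, relative to any oracle, behaves like
-- the original relative to `noOracle`.  This lets the recursive enumeration
-- of the subset relation be used inside a computation relative to φ.

eraseOracle : ∀ {n} → Code n → Code n
eraseOracles : ∀ {n m} → Vec (Code n) m → Vec (Code n) m
eraseOracle zer         = zer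
eraseOracle succ        = succ
eraseOracle (proj i)    = proj i
eraseOracle orac        = zer
eraseOracle (comp f gs) = comp (eraseOracle f) (eraseOracles gs)
eraseOracle (prec g h)  = prec (eraseOracle g) (eraseOracle h)
eraseOracle (mu f)      = mu (eraseOracle f)
eraseOracles []       = []
eraseOracles (g ∷ gs) = eraseOracle g ∷ eraseOracles gs

module _ (φ : ℕ → ℕ) where
  eraseOracle-sound : ∀ {n} {c : Code n} {xs y} →
    Eval noOracle c xs y → Eval φ (eraseOracle c) xs y
  eraseOracles-sound : ∀ {n m} {gs : Vec (Code n) m} {xs ys} →
    EvalAll noOracle gs xs ys → EvalAll φ (eraseOracles gs) xs ys
  eraseOracle-sound ev-zer               = ev-zer
  eraseOracle-sound ev-succ              = ev-succ
  eraseOracle-sound ev-proj              = ev-proj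
  eraseOracle-sound ev-orac              = ev-zer
  eraseOracle-sound (ev-comp ds d)       = ev-comp (eraseOracles-sound ds) (eraseOracle-sound d)
  eraseOracle-sound (ev-prec-zero d)     = ev-prec-zero (eraseOracle-sound d)
  eraseOracle-sound (ev-prec-suc d d′)   = ev-prec-suc (eraseOracle-sound d) (eraseOracle-sound d′)
  eraseOracle-sound (ev-mu d below)      =
    ev-mu (eraseOracle-sound d) (λ i i<y → proj₁ (below i i<y) , eraseOracle-sound (proj₂ (below i i<y)))
  eraseOracles-sound []       = []
  eraseOracles-sound (d ∷ ds) = eraseOracle-sound d ∷ eraseOracles-sound ds

-- The combinators below mirror the program constructors, so that a program
-- built from them is verified by the same expression that builds it.

module _ (φ : ℕ → ℕ) where
  Computes : ∀ {n} → Code n → (Vec ℕ n → ℕ) → Set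
  Computes c F = ∀ xs → Eval φ c xs (F xs)

  computes-ext : ∀ {n} {c : Code n} {F G} → Computes c F → (∀ xs → F xs ≡ G xs) → Computes c G
  computes-ext {c = c} cF F≗G xs = subst (Eval φ c xs) (F≗G xs) (cF xs)

  zerᶜ : ∀ {n} → Computes (zer {n}) (λ _ → 0)
  zerᶜ _ = ev-zer

  succᶜ : Computes succ (λ xs → suc (head xs))
  succᶜ (_ ∷ []) = ev-succ

  oracᶜ : Computes orac (λ xs → φ (head xs))
  oracᶜ (_ ∷ []) = ev-orac

  projᶜ : ∀ {n} (i : Fin n) → Computes (proj i) (λ xs → lookup xs i)
  projᶜ i _ = ev-proj

  comp₁ᶜ : ∀ {n} {f : Code 1} {g : Code n} {F G} → Computes f F → Computes g G →
           Computes (comp f (g ∷ [])) (λ xs → F (G xs ∷ []))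
  comp₁ᶜ cf cg xs = ev-comp (cg xs ∷ []) (cf _)

  comp₂ᶜ : ∀ {n} {f : Code 2} {g₁ g₂ : Code n} {F G₁ G₂} →
           Computes f F → Computes g₁ G₁ → Computes g₂ G₂ →
           Computes (comp f (g₁ ∷ g₂ ∷ [])) (λ xs → F (G₁ xs ∷ G₂ xs ∷ []))
  comp₂ᶜ cf c₁ c₂ xs = ev-comp (c₁ xs ∷ c₂ xs ∷ []) (cf _)

  comp₃ᶜ : ∀ {n} {f : Code 3} {g₁ g₂ g₃ : Code n} {F G₁ G₂ G₃} →
           Computes f F → Computes g₁ G₁ → Computes g₂ G₂ → Computes g₃ G₃ →
           Computes (comp f (g₁ ∷ g₂ ∷ g₃ ∷ [])) (λ xs → F (G₁ xs ∷ G₂ xs ∷ G₃ xs ∷ []))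
  comp₃ᶜ cf c₁ c₂ c₃ xs = ev-comp (c₁ xs ∷ c₂ xs ∷ c₃ xs ∷ []) (cf _)

  precᶜ : ∀ {n} {g : Code n} {h : Code (suc (suc n))} {G H} (F : Vec ℕ (suc n) → ℕ) →
          Computes g G → Computes h H →
          (∀ xs → F (0 ∷ xs) ≡ G xs) →
          (∀ k xs → F (suc k ∷ xs) ≡ H (k ∷ F (k ∷ xs) ∷ xs)) →
          Computes (prec g h) F
  precᶜ {g = g} {h} F cg ch base step (zero ∷ xs) =
    subst (Eval φ (prec g h) (0 ∷ xs)) (sym (base xs)) (ev-prec-zero (cg xs))
  precᶜ {g = g} {h} F cg ch base step (suc k ∷ xs) =
    subst (Eval φ (prec g h) (suc k ∷ xs)) (sym (step k xs))
      (ev-prec-suc (precᶜ F cg ch base step (k ∷ xs)) (ch _))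

-- Arithmetic used by the completion.  `diagonal m` is the index s of the
-- diagonal a + b = s of Cantor's enumeration containing m; it grows by one
-- exactly when m + 1 reaches triangle (s + 1), i.e. when `1 ∸ (triangle (s+1) ∸ (m+1))` is 1.

diagonal : ℕ → ℕ
diagonal zero    = 0
diagonal (suc m) = diagonal m + (1 ∸ (triangle (suc (diagonal m)) ∸ suc m))

unpair₂ : ℕ → ℕ
unpair₂ m = m ∸ triangle (diagonal m)

unpair₁ : ℕ → ℕ
unpair₁ m = diagonal m ∸ unpair₂ m

distance : ℕ → ℕ → ℕ
distance a b = (a ∸ b) + (b ∸ a)

ifZero : ℕ → ℕ → ℕ → ℕ
ifZero zero    u v = u
ifZero (suc _) u v = v

x₀ : ∀ {n} → Code (suc n)
x₀ = proj #0

x₁ : ∀ {n} → Code (suc (suc n))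
x₁ = proj (#suc #0)

one : ∀ {n} → Code n
one = comp succ (zer ∷ [])

addP : Code 2
addP = prec x₀ (comp succ (x₁ ∷ []))

predP : Code 1
predP = prec zer x₀

-- monusP (k , a) = a ∸ k
monusP : Code 2
monusP = prec x₀ (comp predP (x₁ ∷ []))

triangleP : Code 1
triangleP = prec zer (comp addP (comp succ (x₀ ∷ []) ∷ x₁ ∷ []))

diagonalStepP : Code 2
diagonalStepP = comp monusP
  (comp monusP (comp succ (x₀ ∷ []) ∷ comp triangleP (comp succ (x₁ ∷ []) ∷ []) ∷ []) ∷ one ∷ [])

diagonalP : Code 1
diagonalP = prec zer (comp addP (x₁ ∷ diagonalStepP ∷ []))

unpair₂P : Code 1
unpair₂P = comp monusP (comp triangleP (diagonalP ∷ []) ∷ x₀ ∷ [])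

unpair₁P : Code 1
unpair₁P = comp monusP (unpair₂P ∷ diagonalP ∷ [])

distanceP : Code 2
distanceP = comp addP (comp monusP (x₁ ∷ x₀ ∷ []) ∷ comp monusP (x₀ ∷ x₁ ∷ []) ∷ [])

ifZeroP : Code 3
ifZeroP = prec x₀ (proj (#suc (#suc (#suc #0))))

module _ (φ : ℕ → ℕ) where
  addᶜ : Computes φ addP (λ xs → lookup xs #0 + lookup xs (#suc #0))
  addᶜ = precᶜ φ _ (projᶜ φ #0) (comp₁ᶜ φ (succᶜ φ) (projᶜ φ (#suc #0)))
           (λ { (_ ∷ []) → refl }) (λ { _ (_ ∷ []) → refl })

  predᶜ : Computes φ predP (λ xs → pred (head xs))
  predᶜ = precᶜ φ _ (zerᶜ φ) (projᶜ φ #0) (λ { [] → refl }) (λ { _ [] → refl })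

  monusᶜ : Computes φ monusP (λ xs → lookup xs (#suc #0) ∸ lookup xs #0)
  monusᶜ = precᶜ φ _ (projᶜ φ #0) (comp₁ᶜ φ predᶜ (projᶜ φ (#suc #0)))
             (λ { (_ ∷ []) → refl }) (λ { k (a ∷ []) → sym (pred[m∸n]≡m∸[1+n] a k) })

  triangleᶜ : Computes φ triangleP (λ xs → triangle (head xs))
  triangleᶜ = precᶜ φ _ (zerᶜ φ)
                (comp₂ᶜ φ addᶜ (comp₁ᶜ φ (succᶜ φ) (projᶜ φ #0)) (projᶜ φ (#suc #0)))
                (λ { [] → refl }) (λ { _ [] → refl })

  diagonalStepᶜ : Computes φ diagonalStepP
    (λ xs → 1 ∸ (triangle (suc (lookup xs (#suc #0))) ∸ suc (lookup xs #0)))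
  diagonalStepᶜ = computes-ext φ
    (comp₂ᶜ φ monusᶜ
      (comp₂ᶜ φ monusᶜ (comp₁ᶜ φ (succᶜ φ) (projᶜ φ #0))
                       (comp₁ᶜ φ triangleᶜ (comp₁ᶜ φ (succᶜ φ) (projᶜ φ (#suc #0)))))
      (comp₁ᶜ φ (succᶜ φ) (zerᶜ φ)))
    (λ { (_ ∷ _ ∷ []) → refl })

  diagonalᶜ : Computes φ diagonalP (λ xs → diagonal (head xs))
  diagonalᶜ = precᶜ φ _ (zerᶜ φ) (comp₂ᶜ φ addᶜ (projᶜ φ (#suc #0)) diagonalStepᶜ)
                (λ { [] → refl }) (λ { _ [] → refl })

  unpair₂ᶜ : Computes φ unpair₂P (λ xs → unpair₂ (head xs))
  unpair₂ᶜ = computes-ext φ (comp₂ᶜ φ monusᶜ (comp₁ᶜ φ triangleᶜ diagonalᶜ) (projᶜ φ #0))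
               (λ { (_ ∷ []) → refl })

  unpair₁ᶜ : Computes φ unpair₁P (λ xs → unpair₁ (head xs))
  unpair₁ᶜ = computes-ext φ (comp₂ᶜ φ monusᶜ unpair₂ᶜ diagonalᶜ) (λ { (_ ∷ []) → refl })

  distanceᶜ : Computes φ distanceP (λ xs → distance (lookup xs #0) (lookup xs (#suc #0)))
  distanceᶜ = computes-ext φ
    (comp₂ᶜ φ addᶜ (comp₂ᶜ φ monusᶜ (projᶜ φ (#suc #0)) (projᶜ φ #0))
                   (comp₂ᶜ φ monusᶜ (projᶜ φ #0) (projᶜ φ (#suc #0))))
    (λ { (_ ∷ _ ∷ []) → refl })

  ifZeroᶜ : Computes φ ifZeroP
    (λ xs → ifZero (lookup xs #0) (lookup xs (#suc #0)) (lookup xs (#suc (#suc #0))))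
  ifZeroᶜ = precᶜ φ _ (projᶜ φ #0) (projᶜ φ (#suc (#suc (#suc #0))))
              (λ { (_ ∷ _ ∷ []) → refl }) (λ { _ (_ ∷ _ ∷ []) → refl })

-- Correctness of unpairing.  m lies on diagonal s iff triangle s ≤ m < triangle (s+1);
-- `diagonal m` is such an s, and s is unique since triangle is monotone.

OnDiagonal : ℕ → ℕ → Set
OnDiagonal m s = (triangle s ≤ m) × (m < triangle (suc s))

triangle-mono : ∀ {s t} → s ≤ t → triangle s ≤ triangle t
triangle-mono z≤n = z≤n
triangle-mono {suc s} {suc t} (s≤s s≤t) = +-mono-≤ (s≤s s≤t) (triangle-mono s≤t)

-- Inductive step: from diagonal s at m, the increment computed by `diagonal`
-- lands on the diagonal of m + 1 (one further exactly when m + 1 = triangle (s+1)).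
onDiagonal-step : ∀ m s → OnDiagonal m s →
  OnDiagonal (suc m) (s + (1 ∸ (triangle (suc s) ∸ suc m)))
onDiagonal-step m s (lo , hi) with triangle (suc s) ≤? suc m
... | yes reached = subst (OnDiagonal (suc m)) (sym next) (reached , hi′)
  where
  next : s + (1 ∸ (triangle (suc s) ∸ suc m)) ≡ suc s
  next = trans (cong (λ d → s + (1 ∸ d)) (m≤n⇒m∸n≡0 reached)) (+-comm s 1)
  hi′ : suc m < triangle (suc (suc s))
  hi′ = ≤-trans (s≤s hi) (s≤s (m≤n+m (triangle (suc s)) (suc s)))
... | no notReached = subst (OnDiagonal (suc m)) (sym same) (≤-trans lo (n≤1+n m) , ≰⇒> notReached)
  where
  same : s + (1 ∸ (triangle (suc s) ∸ suc m)) ≡ s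
  same with triangle (suc s) ∸ suc m in gap
  ... | zero  = ⊥-elim (notReached (m∸n≡0⇒m≤n gap))
  ... | suc d = trans (cong (s +_) (0∸n≡0 d)) (+-identityʳ s)

diagonal-correct : ∀ m → OnDiagonal m (diagonal m)
diagonal-correct zero    = z≤n , s≤s z≤n
diagonal-correct (suc m) = onDiagonal-step m (diagonal m) (diagonal-correct m)

onDiagonal-unique : ∀ {m s t} → OnDiagonal m s → OnDiagonal m t → s ≡ t
onDiagonal-unique {s = s} {t} (lo₁ , hi₁) (lo₂ , hi₂) with <-cmp s t
... | tri≈ _ s≡t _ = s≡t
... | tri< s<t _ _ = ⊥-elim (<-irrefl refl (<-≤-trans hi₁ (≤-trans (triangle-mono s<t) lo₂)))
... | tri> _ _ t<s = ⊥-elim (<-irrefl refl (<-≤-trans hi₂ (≤-trans (triangle-mono t<s) lo₁)))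

diagonal-pair : ∀ a b → diagonal ⟨ a , b ⟩ ≡ a + b
diagonal-pair a b = onDiagonal-unique (diagonal-correct ⟨ a , b ⟩) (lo , s≤s hi)
  where
  lo : triangle (a + b) ≤ ⟨ a , b ⟩
  lo = m≤m+n (triangle (a + b)) b
  hi : ⟨ a , b ⟩ ≤ a + b + triangle (a + b)
  hi = subst (⟨ a , b ⟩ ≤_) (+-comm (triangle (a + b)) (a + b))
             (+-monoʳ-≤ (triangle (a + b)) (m≤n+m b a))

unpair₂-pair : ∀ a b → unpair₂ ⟨ a , b ⟩ ≡ b
unpair₂-pair a b = begin
  ⟨ a , b ⟩ ∸ triangle (diagonal ⟨ a , b ⟩) ≡⟨ cong (λ s → ⟨ a , b ⟩ ∸ triangle s) (diagonal-pair a b) ⟩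
  triangle (a + b) + b ∸ triangle (a + b)   ≡⟨ m+n∸m≡n (triangle (a + b)) b ⟩
  b                                         ∎
  where open ≡-Reasoning

unpair₁-pair : ∀ a b → unpair₁ ⟨ a , b ⟩ ≡ a
unpair₁-pair a b = trans (cong₂ _∸_ (diagonal-pair a b) (unpair₂-pair a b)) (m+n∸n≡m a b)

distance-self : ∀ a → distance a a ≡ 0
distance-self a = cong₂ _+_ (n∸n≡0 a) (n∸n≡0 a)

distance≡0⇒≡ : ∀ a b → distance a b ≡ 0 → a ≡ b
distance≡0⇒≡ a b d≡0 =
  ≤-antisym (m∸n≡0⇒m≤n (m+n≡0⇒m≡0 (a ∸ b) d≡0)) (m∸n≡0⇒m≤n (m+n≡0⇒n≡0 (a ∸ b) d≡0))

ifZero-elim : ∀ (P : ℕ → Set) d u v → (d ≡ 0 → P u) → P v → P (ifZero d u v)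
ifZero-elim P zero    u v Pu Pv = Pu refl
ifZero-elim P (suc _) u v Pu Pv = Pv

module _ {X : Set} (dom : ℕ → Set) (ν : ℕ → X → Set) where

  SubsetPair : ℕ → Set
  SubsetPair m = Σ ℕ (λ b₁ → Σ ℕ (λ b₂ →
                   (m ≡ ⟨ b₁ , b₂ ⟩) × dom b₁ × dom b₂ × (_⊆ν_ dom ν b₁ b₂)))

  oracle⇒SubsetPair : ∀ {x φ} → IsOracle dom ν x φ → SubsetPair ⟨ φ 0 , φ 0 ⟩
  oracle⇒SubsetPair {φ = φ} (inDom , _ , _) = φ 0 , φ 0 , refl , inDom 0 , inDom 0 , λ _ y∈ → y∈

  complete⇒oracle : ∀ {x ψ} → (∀ k → dom (ψ k)) → (∀ k → ν (ψ k) x) →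
    (∀ n → dom n → ν n x → Σ ℕ (λ k → ψ k ≡ n)) → IsCompleteOracle dom ν x ψ
  complete⇒oracle {x} {ψ} inDom contains complete =
    (inDom , contains , localBasis) , complete
    where
    localBasis : ∀ n → dom n → ν n x → Σ ℕ (λ k → _⊆ν_ dom ν (ψ k) n)
    localBasis n dn x∈n with complete n dn x∈n
    ... | k , ψk≡n = k , λ y y∈ → subst (λ b → ν b y) ψk≡n y∈

  -- ψ ⟨j,k⟩ = b₂ if e j = ⟨b₁,b₂⟩ with b₁ = φ k, and φ 0 otherwise.
  completion : (e φ : ℕ → ℕ) → ℕ → ℕ
  completion e φ m =
    ifZero (distance (unpair₁ (e (unpair₁ m))) (φ (unpair₂ m))) (unpair₂ (e (unpair₁ m))) (φ 0)

  completion-isComplete : ∀ (e : ℕ → ℕ) → (∀ n → SubsetPair n ⇔ ∃ (λ j → e j ≡ n)) →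
    ∀ x φ → IsOracle dom ν x φ → IsCompleteOracle dom ν x (completion e φ)
  completion-isComplete e enum x φ (φ-inDom , φ-contains , φ-local) =
    complete⇒oracle inDom contains complete
    where
    enumerated : ∀ j → SubsetPair (e j)
    enumerated j = Equivalence.from (enum (e j)) (j , refl)

    -- A selected value is the superset of a pair whose subset is φ k ∋ x.
    selected : ∀ m → distance (unpair₁ (e (unpair₁ m))) (φ (unpair₂ m)) ≡ 0 →
               dom (unpair₂ (e (unpair₁ m))) × ν (unpair₂ (e (unpair₁ m))) x
    selected m match with enumerated (unpair₁ m)
    ... | b₁ , b₂ , e≡ , _ , dom-b₂ , b₁⊆b₂ rewrite e≡ | unpair₁-pair b₁ b₂ | unpair₂-pair b₁ b₂ =
      dom-b₂ , b₁⊆b₂ x (subst (λ b → ν b x) (sym (distance≡0⇒≡ b₁ _ match)) (φ-contains (unpair₂ m)))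

    inDom : ∀ m → dom (completion e φ m)
    inDom m = ifZero-elim dom _ _ _ (λ match → proj₁ (selected m match)) (φ-inDom 0)

    contains : ∀ m → ν (completion e φ m) x
    contains m = ifZero-elim (λ b → ν b x) _ _ _ (λ match → proj₂ (selected m match)) (φ-contains 0)

    -- n ⊇ φ k, so ⟨φ k, n⟩ = e j for some j, and ⟨j,k⟩ selects n.
    complete : ∀ n → dom n → ν n x → Σ ℕ (λ m → completion e φ m ≡ n)
    complete n dom-n x∈n with φ-local n dom-n x∈n
    ... | k , φk⊆n with Equivalence.to (enum ⟨ φ k , n ⟩) (φ k , n , refl , φ-inDom k , dom-n , φk⊆n)
    ...   | j , ej≡ = ⟨ j , k ⟩ , selects
      where
      selects : completion e φ ⟨ j , k ⟩ ≡ n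
      selects rewrite unpair₁-pair j k | unpair₂-pair j k | ej≡
                    | unpair₁-pair (φ k) n | unpair₂-pair (φ k) n | distance-self (φ k) = refl

completionP : Code 1 → Code 1
completionP E = comp ifZeroP
  ( comp distanceP (comp unpair₁P (comp E (unpair₁P ∷ []) ∷ []) ∷ comp orac (unpair₂P ∷ []) ∷ [])
  ∷ comp unpair₂P (comp E (unpair₁P ∷ []) ∷ [])
  ∷ comp orac (zer ∷ [])
  ∷ [])

completionP-computes : ∀ {X : Set} (dom : ℕ → Set) (ν : ℕ → X → Set) {E e} φ →
  Computes φ E (λ xs → e (head xs)) → ComputedBy φ (completionP E) (completion dom ν e φ)
completionP-computes dom ν {e = e} φ Eᶜ m =
  computes-ext φ {G = λ xs → completion dom ν e φ (head xs)}
    (comp₃ᶜ φ (ifZeroᶜ φ)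
      (comp₂ᶜ φ (distanceᶜ φ) (comp₁ᶜ φ (unpair₁ᶜ φ) (comp₁ᶜ φ Eᶜ (unpair₁ᶜ φ)))
                              (comp₁ᶜ φ (oracᶜ φ) (unpair₂ᶜ φ)))
      (comp₁ᶜ φ (unpair₂ᶜ φ) (comp₁ᶜ φ Eᶜ (unpair₁ᶜ φ)))
      (comp₁ᶜ φ (oracᶜ φ) (zerᶜ φ)))
    (λ { (_ ∷ []) → refl }) (m ∷ [])

theorem7 : {X : Set} (dom : ℕ → Set) (ν : ℕ → X → Set) →
    IsEffectiveTopology dom ν → REsubset dom ν →
    Σ (Code 1) (λ c → (x : X) (φ : ℕ → ℕ) → IsOracle dom ν x φ →
      Σ (ℕ → ℕ) (λ ψ → ComputedBy φ c ψ × IsCompleteOracle dom ν x ψ))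
-- An empty subset relation admits no oracle at all.
theorem7 dom ν _ (inj₁ empty) =
  zer , λ x φ isOracle → ⊥-elim (empty _ (oracle⇒SubsetPair dom ν isOracle))
-- Otherwise complete φ along the enumeration, run without its (irrelevant) oracle.
theorem7 dom ν _ (inj₂ (E , e , E-computes , enum)) =
  completionP (eraseOracle E) , λ x φ isOracle →
    completion dom ν e φ ,
    completionP-computes dom ν φ (λ { (n ∷ []) → eraseOracle-sound φ (E-computes n) }) ,
    completion-isComplete dom ν e enum x φ isOracle
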